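{- Let $S$ be a set and $\to\subseteq S\times S$ a binary relation. Let $P,R,Q\subseteq S\times S$, $F_0,F_1\subseteq(S\times S)\times(S\times S)$ and $n_0,n_1,m_0,m_1\in\mathbb{N}$. If $\mathrm{Ensures2}_{\to}(P,R,F_0,\lambda s.\,n_0,\lambda s.\,m_0)$ and $\mathrm{Ensures2}_{\to}(R,Q,F_1,\lambda s.\,n_1,\lambda s.\,m_1)$ hold, then $\mathrm{Ensures2}_{\to}(P,Q,F_0\circ F_1,\lambda s.\,n_0+n_1,\lambda s.\,m_0+m_1)$ holds, where $F_0\circ F_1=\{(x,z)\mid\exists y.\ (x,y)\in F_0\wedge(y,z)\in F_1\}$.
   Context: For $n\in\mathbb{N}$, $\to^n$ denotes the $n$-fold composition of $\to$, with $\to^0$ the identity relation on $S$. For $n\in\mathbb{N}$ and $Q\subseteq S$, $\mathrm{EvN}_{\to}(n,Q)=\{s\in S\mid (\forall s'.\ s\to^n s'\Rightarrow s'\in Q)\wedge(\forall s'\,\forall l<n.\ s\to^l s'\Rightarrow\exists s''.\ s'\to s'')\}$. For $P,Q\subseteq S\times S$, $F\subseteq(S\times S)\times(S\times S)$ and $c_0,c_1:S\to\mathbb{N}$, $\mathrm{Ensures2}_{\to}(P,Q,F,c_0,c_1)$ means: for all $(s_0,s_1)\in P$, $s_0\in\mathrm{EvN}_{\to}\big(c_0(s_0),\{s_0'\mid s_1\in\mathrm{EvN}_{\to}(c_1(s_1),\{s_1'\mid (s_0',s_1')\in Q\wedge((s_0,s_1),(s_0',s_1'))\in F\})\}\big)$.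 -}

module Defs where

open import Level using (Level; _⊔_; suc)
open import Data.Nat using (ℕ; zero; suc; _+_; _<_)
open import Data.Product using (Σ; ∃; _×_; _,_)
open import Relation.Binary.PropositionalEquality using (_≡_)

Rel : ∀ {a} (S : Set a) → Set (Level.suc a)
Rel {a} S = S → S → Set a

Pred : ∀ {a} (S : Set a) → Set (Level.suc a)
Pred {a} S = S → Set a

_^[_] : ∀ {a} {S : Set a} → Rel S → ℕ → Rel S
(_⟶_ ^[ zero ]) s s' = s ≡ s'
(_⟶_ ^[ suc n ]) s s' = ∃ λ t → (s ⟶ t) × (_⟶_ ^[ n ]) t s'

EvN : ∀ {a} {S : Set a} → Rel S → ℕ → Pred S → Pred S
EvN _⟶_ n Q s =
  (∀ s' → (_⟶_ ^[ n ]) s s' → Q s') ×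
  (∀ s' l → l < n → (_⟶_ ^[ l ]) s s' → ∃ λ s'' → s' ⟶ s'')

Ensures2 : ∀ {a} {S : Set a} → Rel S → Pred (S × S) → Pred (S × S) →
           Rel (S × S) → (S → ℕ) → (S → ℕ) → Set a
Ensures2 _⟶_ P Q F c₀ c₁ =
  ∀ s₀ s₁ → P (s₀ , s₁) →
  EvN _⟶_ (c₀ s₀)
    (λ s₀' → EvN _⟶_ (c₁ s₁)
       (λ s₁' → Q (s₀' , s₁') × F (s₀ , s₁) (s₀' , s₁')) s₁)
    s₀

_∘ᴿ_ : ∀ {a} {S : Set a} → Rel S → Rel S → Rel S
(F₀ ∘ᴿ F₁) x z = ∃ λ y → F₀ x y × F₁ y z

{-# OPTIONS --safe #-}
module Submission where

open import Defs
open import Data.Nat using (ℕ; zero; suc; _+_; z<s; s<s)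
open import Data.Product using (_×_; _,_; proj₁; proj₂; ∃)
open import Relation.Binary.PropositionalEquality using (refl)

-- Each side of the composite runs its first-guarantee phase and then its
-- second-guarantee phase.  The second guarantee only applies once both
-- intermediate states t₀, t₁ are fixed, whereas the composite must settle side 0
-- before side 1; so the side-1 phase of length m₀ has to be commuted past the
-- side-0 phase of length n₁.  This is sound because a run that cannot deadlock
-- for m₀ steps does reach some t₁, which is what guarantees progress from t₀.

module _ {a} {S : Set a} (_⟶_ : Rel S) where

  EvN-mono : ∀ {n} {Q Q′ : Pred S} → (∀ {s} → Q s → Q′ s) →
             ∀ {s} → EvN _⟶_ n Q s → EvN _⟶_ n Q′ s
  EvN-mono Q⊆Q′ (post , live) = (λ s′ p → Q⊆Q′ (post s′ p)) , live

  EvN-enabled : ∀ {n Q s} → EvN _⟶_ (suc n) Q s → ∃ λ u → s ⟶ u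
  EvN-enabled (_ , live) = live _ 0 z<s refl

  EvN-step : ∀ {n Q s u} → EvN _⟶_ (suc n) Q s → s ⟶ u → EvN _⟶_ n Q u
  EvN-step {u = u} (post , live) s⟶u =
    (λ s′ p → post s′ (u , s⟶u , p)) ,
    (λ s′ l l<n p → live s′ (suc l) (s<s l<n) (u , s⟶u , p))

  EvN-suc : ∀ {n Q s} → (∃ λ u → s ⟶ u) →
            (∀ u → s ⟶ u → EvN _⟶_ n Q u) → EvN _⟶_ (suc n) Q s
  EvN-suc enabled next = post , live
    where
    post = λ { s′ (u , s⟶u , p) → proj₁ (next u s⟶u) s′ p }
    live = λ { s′ zero _ refl → enabled
             ; s′ (suc l) (s<s l<n) (u , s⟶u , p) → proj₂ (next u s⟶u) s′ l l<n p }

  EvN-reachable : ∀ n {Q s} → EvN _⟶_ n Q s → ∃ λ t → (_⟶_ ^[ n ]) s t × Q t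
  EvN-reachable zero {s = s} (post , _) = s , refl , post s refl
  EvN-reachable (suc n) h with EvN-enabled h
  ... | u , s⟶u with EvN-reachable n (EvN-step h s⟶u)
  ...   | t , p , q = t , (u , s⟶u , p) , q

  EvN-join : ∀ m {n Q s} → EvN _⟶_ m (EvN _⟶_ n Q) s → EvN _⟶_ (m + n) Q s
  EvN-join zero {s = s} (post , _) = post s refl
  EvN-join (suc m) h = EvN-suc (EvN-enabled h) (λ u s⟶u → EvN-join m (EvN-step h s⟶u))

  EvN-swap : ∀ m n {A : S → S → Set a} {x z} →
             EvN _⟶_ m (λ y → EvN _⟶_ n (A y) z) x →
             EvN _⟶_ n (λ w → EvN _⟶_ m (λ y → A y w) x) z
  EvN-swap m n h@(post , live) =
    (λ w q → (λ y p → proj₁ (post y p) w q) , live) ,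
    proj₂ (proj₂ (proj₂ (EvN-reachable m h)))

lemma3 : ∀ {a} {S : Set a} (_⟶_ : Rel S) (P R Q : Pred (S × S)) (F₀ F₁ : Rel (S × S))
           (n₀ n₁ m₀ m₁ : ℕ) →
           Ensures2 _⟶_ P R F₀ (λ _ → n₀) (λ _ → m₀) →
           Ensures2 _⟶_ R Q F₁ (λ _ → n₁) (λ _ → m₁) →
           Ensures2 _⟶_ P Q (F₀ ∘ᴿ F₁) (λ _ → n₀ + n₁) (λ _ → m₀ + m₁)
lemma3 _⟶_ P R Q F₀ F₁ n₀ n₁ m₀ m₁ h₀ h₁ s₀ s₁ p =
  EvN-join _⟶_ n₀ (EvN-mono _⟶_ second-phase (h₀ s₀ s₁ p))
  where
  second-phase : ∀ {t₀} →
    EvN _⟶_ m₀ (λ t₁ → R (t₀ , t₁) × F₀ (s₀ , s₁) (t₀ , t₁)) s₁ →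
    EvN _⟶_ n₁ (λ s₀′ → EvN _⟶_ (m₀ + m₁)
      (λ s₁′ → Q (s₀′ , s₁′) × (F₀ ∘ᴿ F₁) (s₀ , s₁) (s₀′ , s₁′)) s₁) t₀
  second-phase {t₀} h =
    EvN-mono _⟶_ (EvN-join _⟶_ m₀) (EvN-swap _⟶_ m₀ n₁ (EvN-mono _⟶_ chain h))
    where
    chain : ∀ {t₁} → R (t₀ , t₁) × F₀ (s₀ , s₁) (t₀ , t₁) →
            EvN _⟶_ n₁ (λ s₀′ → EvN _⟶_ m₁
              (λ s₁′ → Q (s₀′ , s₁′) × (F₀ ∘ᴿ F₁) (s₀ , s₁) (s₀′ , s₁′)) t₁) t₀
    chain {t₁} (r , f₀) =
      EvN-mono _⟶_ (EvN-mono _⟶_ (λ (q , f₁) → q , (t₀ , t₁) , f₀ , f₁)) (h₁ t₀ t₁ r)
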